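{- Let $q$ be a power of an odd prime and let $k \geq 2$ be an integer. Then the graph $\Gamma^\square(k,q)$ contains no clique on $k$ vertices, i.e. it is $K_k$-free.
   Context: Fix a non-square $\xi \in \mathbb{F}_q$ and define the quadratic form $Q:\mathbb{F}_q^k \to \mathbb{F}_q$ by $Q(x_1,\dots,x_k) = \xi x_1^2 + \sum_{i=2}^k x_i^2$. The points of the projective space $\mathrm{PG}(k-1,q)$ are the $1$-dimensional subspaces of $\mathbb{F}_q^k$. Two points $x=\langle (x_1,\dots,x_k)\rangle$ and $y=\langle (y_1,\dots,y_k)\rangle$ are called orthogonal if $\xi x_1y_1 + \sum_{i=2}^k x_iy_i = 0$. Let $X_\square$ be the set of points $x$ of $\mathrm{PG}(k-1,q)$ such that $Q(x)$ is a non-zero square in $\mathbb{F}_q$ (this is well defined since $Q(\lambda v)=\lambda^2 Q(v)$). The graph $\Gamma^\square(k,q)$ has vertex set $X_\square$, with two vertices adjacent if and only if they are orthogonal. -}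

module Defs where

open import Level using (Level; _⊔_)
open import Algebra.Bundles using (CommutativeRing)
open import Data.Nat using (ℕ; zero; suc; _^_; _≤_)
open import Data.Nat.Primality using (Prime)
open import Data.Fin using (Fin; zero; suc)
open import Data.Product using (Σ; ∃; _×_; _,_)
open import Relation.Nullary using (¬_)
open import Relation.Binary.PropositionalEquality as ≡ using (_≡_; _≢_)
open import Function.Bundles using (Inverse)

OddPrimePower : ℕ → Set
OddPrimePower q = Σ ℕ λ p → Σ ℕ λ n → Prime p × p ≢ 2 × 1 ≤ n × q ≡ p ^ n

module _ {c ℓ : Level} (R : CommutativeRing c ℓ) where
  open CommutativeRing R hiding (zero)

  IsField : Set (c ⊔ ℓ)
  IsField = (¬ (1# ≈ 0#)) × (∀ x → ¬ (x ≈ 0#) → ∃ λ y → x * y ≈ 1#)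

  HasSize : ℕ → Set (c ⊔ ℓ)
  HasSize q = Inverse (≡.setoid (Fin q)) setoid

  IsFiniteFieldOfOrder : ℕ → Set (c ⊔ ℓ)
  IsFiniteFieldOfOrder q = IsField × HasSize q

  IsSquare : Carrier → Set (c ⊔ ℓ)
  IsSquare a = ∃ λ y → y * y ≈ a

  IsNonzeroSquare : Carrier → Set (c ⊔ ℓ)
  IsNonzeroSquare a = (¬ (a ≈ 0#)) × IsSquare a

  sumF : ∀ {n} → (Fin n → Carrier) → Carrier
  sumF {zero} f = 0#
  sumF {suc n} f = f zero + sumF (λ i → f (suc i))

  -- vectors in 𝔽_q^k are functions Fin k → Carrier; coordinate zero is x₁
  -- Q(x) = ξ x₁² + Σ_{i ≥ 2} x_i²
  Q : ∀ {k} → Carrier → (Fin k → Carrier) → Carrier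
  Q {zero} ξ x = 0#
  Q {suc k} ξ x = ξ * (x zero * x zero) + sumF (λ i → x (suc i) * x (suc i))

  B : ∀ {k} → Carrier → (Fin k → Carrier) → (Fin k → Carrier) → Carrier
  B {zero} ξ x y = 0#
  B {suc k} ξ x y = ξ * (x zero * y zero) + sumF (λ i → x (suc i) * y (suc i))

  IsZeroVec : ∀ {k} → (Fin k → Carrier) → Set ℓ
  IsZeroVec x = ∀ i → x i ≈ 0#

  -- two nonzero vectors span the same 1-dimensional subspace (same projective point)
  SamePoint : ∀ {k} → (Fin k → Carrier) → (Fin k → Carrier) → Set (c ⊔ ℓ)
  SamePoint x y = ∃ λ λ′ → ∀ i → x i ≈ λ′ * y i

  -- a point of PG(k-1,q) (given by a nonzero representative) lying in X_□
  InXSquare : ∀ {k} → Carrier → (Fin k → Carrier) → Set (c ⊔ ℓ)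
  InXSquare ξ x = (¬ IsZeroVec x) × IsNonzeroSquare (Q ξ x)

  -- a clique on m vertices in Γ^□(k,q): m pairwise distinct points of X_□,
  -- pairwise orthogonal
  IsClique : ∀ {k m} → Carrier → (Fin m → (Fin k → Carrier)) → Set (c ⊔ ℓ)
  IsClique ξ v =
    (∀ a → InXSquare ξ (v a)) ×
    (∀ a b → a ≢ b → (¬ SamePoint (v a) (v b)) × (B ξ (v a) (v b) ≈ 0#))

module Submission where

-- A k-clique would be a family v₀,…,v_{k-1} of vectors of F^k, pairwise
-- orthogonal for B = diag(ξ,1,…,1), with every Q(vⱼ) a nonzero square.  The
-- Gram matrix (B(vᵢ,vⱼ)) = vᵀ·diag(ξ,1,…,1)·v is then diag(Q(v₀),…), so
--     Q(v₀)⋯Q(v_{k-1}) = ξ · det(v)².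
-- The left side is a nonzero square; hence det v ≠ 0 and ξ is a square,
-- contradicting the choice of ξ.

open import Level using (Level; _⊔_; Lift; lift)
open import Algebra.Bundles using (CommutativeRing)
open import Data.Nat using (ℕ; zero; suc; _≤_)
open import Data.Fin using (Fin; zero; suc; punchIn; punchOut; inject₁; _≟_)
open import Data.Fin.Properties using (suc-injective; punchIn-injective; punchInᵢ≢i; punchIn-punchOut)
open import Data.Fin.Induction using (<-weakInduction)
open import Data.Vec.Functional using (Vector; _∷_; tail; map; zipWith; updateAt; insertAt; foldr)
open import Data.Vec.Functional.Properties using (updateAt-updates; updateAt-minimal; updateAt-commutes; map-updateAt; insertAt-removeAt)
open import Data.Product using (Σ; ∃; _×_; _,_; proj₁; proj₂)
open import Data.Empty using (⊥; ⊥-elim)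
open import Function using (_∘_; const)
open import Relation.Nullary using (¬_; yes; no)
open import Relation.Binary.PropositionalEquality as ≡ using (_≡_; _≢_)
import Algebra.Properties.Ring as RingProperties
import Algebra.Properties.AbelianGroup as AbelianGroupProperties
import Algebra.Properties.CommutativeSemigroup as CommutativeSemigroupProperties
import Algebra.Properties.Semiring.Sum as SemiringSum
import Data.Vec.Functional.Relation.Binary.Equality.Setoid as VectorEquality
import Relation.Binary.Reasoning.Setoid as SetoidReasoning
open import Defs

_[_]≔_ : ∀ {a} {A : Set a} {m} → Vector A m → Fin m → A → Vector A m
xs [ p ]≔ x = updateAt xs p (const x)

punchIn-suc-self : ∀ {n} (i : Fin n) → punchIn (suc i) i ≡ inject₁ i
punchIn-suc-self zero = ≡.refl
punchIn-suc-self (suc i) = ≡.cong suc (punchIn-suc-self i)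

punchIn-inject₁-self : ∀ {n} (i : Fin n) → punchIn (inject₁ i) i ≡ suc i
punchIn-inject₁-self zero = ≡.refl
punchIn-inject₁-self (suc i) = ≡.cong suc (punchIn-inject₁-self i)

punchIn-suc≡punchIn-inject₁ : ∀ {n} (i k : Fin n) → k ≢ i → punchIn (suc i) k ≡ punchIn (inject₁ i) k
punchIn-suc≡punchIn-inject₁ zero zero k≢i = ⊥-elim (k≢i ≡.refl)
punchIn-suc≡punchIn-inject₁ zero (suc k) _ = ≡.refl
punchIn-suc≡punchIn-inject₁ (suc i) zero _ = ≡.refl
punchIn-suc≡punchIn-inject₁ (suc i) (suc k) k≢i =
  ≡.cong suc (punchIn-suc≡punchIn-inject₁ i k (k≢i ∘ ≡.cong suc))

punchIn-neighbours : ∀ {m} (t : Fin (suc (suc m))) (p : Fin (suc m)) → t ≢ inject₁ p → t ≢ suc p →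
  ∃ λ p′ → punchIn t (inject₁ p′) ≡ inject₁ p × punchIn t (suc p′) ≡ suc p
punchIn-neighbours zero zero t≢p _ = ⊥-elim (t≢p ≡.refl)
punchIn-neighbours (suc zero) zero _ t≢p+1 = ⊥-elim (t≢p+1 ≡.refl)
punchIn-neighbours {suc m} (suc (suc t)) zero _ _ = zero , ≡.refl , ≡.refl
punchIn-neighbours {suc m} zero (suc p) _ _ = p , ≡.refl , ≡.refl
punchIn-neighbours {suc m} (suc t) (suc p) t≢p t≢p+1
  with punchIn-neighbours t p (t≢p ∘ ≡.cong suc) (t≢p+1 ∘ ≡.cong suc)
... | p′ , left , right = suc p′ , ≡.cong suc left , ≡.cong suc right

module LinearAlgebra {c ℓ : Level} (R : CommutativeRing c ℓ) where
  open CommutativeRing R hiding (zero)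
  open RingProperties ring using (-‿distribˡ-*; -1*x≈-x; x+x≈x⇒x≈0)
  open AbelianGroupProperties +-abelianGroup using (inverseˡ-unique) renaming (ε⁻¹≈ε to -0#≈0#)
  module *-Props = CommutativeSemigroupProperties *-commutativeSemigroup
  open SemiringSum semiring using (sum; sum-cong-≋; sum-replicate-zero; ∑-distrib-+; *-distribˡ-sum; *-distribʳ-sum)
  open VectorEquality setoid using (_≋_; ≋-refl; ≋-sym)
  open SetoidReasoning setoid

  ≡⇒≈ : ∀ {x y} → x ≡ y → x ≈ y
  ≡⇒≈ ≡.refl = refl

  V : ℕ → Set c
  V n = Vector Carrier n

  infix 4 _≋ₘ_
  _≋ₘ_ : ∀ {m n} → Vector (V n) m → Vector (V n) m → Set ℓ
  A ≋ₘ B = ∀ j → A j ≋ B j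

  ≋-symₘ : ∀ {m n} {A B : Vector (V n) m} → A ≋ₘ B → B ≋ₘ A
  ≋-symₘ A≋B j = ≋-sym (A≋B j)

  infixl 6 _+ᵥ_
  infixr 7 _•_
  _+ᵥ_ : ∀ {n} → V n → V n → V n
  _+ᵥ_ = zipWith _+_

  _•_ : ∀ {n} → Carrier → V n → V n
  a • x = map (a *_) x

  0ᵥ : ∀ {n} → V n
  0ᵥ = const 0#

  δ : ∀ {n} → Fin n → V n
  δ zero zero = 1#
  δ zero (suc j) = 0#
  δ (suc i) zero = 0#
  δ (suc i) (suc j) = δ i j

  δ-sym : ∀ {n} (i j : Fin n) → δ i j ≡ δ j i
  δ-sym zero zero = ≡.refl
  δ-sym zero (suc j) = ≡.refl
  δ-sym (suc i) zero = ≡.refl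
  δ-sym (suc i) (suc j) = δ-sym i j

  δ-diagonal : ∀ {n} (i : Fin n) → δ i i ≡ 1#
  δ-diagonal zero = ≡.refl
  δ-diagonal (suc i) = δ-diagonal i

  δ-off-diagonal : ∀ {n} (i j : Fin n) → i ≢ j → δ i j ≡ 0#
  δ-off-diagonal zero zero i≢j = ⊥-elim (i≢j ≡.refl)
  δ-off-diagonal zero (suc j) _ = ≡.refl
  δ-off-diagonal (suc i) zero _ = ≡.refl
  δ-off-diagonal (suc i) (suc j) i≢j = δ-off-diagonal i j (i≢j ∘ ≡.cong suc)

  sgn : ∀ {n} → Fin n → Carrier
  sgn zero = 1#
  sgn (suc i) = - sgn i

  sgn-inject₁ : ∀ {n} (i : Fin n) → sgn (inject₁ i) ≡ sgn i
  sgn-inject₁ zero = ≡.refl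
  sgn-inject₁ (suc i) = ≡.cong -_ (sgn-inject₁ i)

  sum-cong : ∀ {n} {g h : V n} → (∀ t → g t ≈ h t) → sum g ≈ sum h
  sum-cong = sum-cong-≋

  sum-zero : ∀ {n} (g : V n) → (∀ t → g t ≈ 0#) → sum g ≈ 0#
  sum-zero {n} g g≈0 = trans (sum-cong g≈0) (sum-replicate-zero n)

  sum-head : ∀ {n} (g : V (suc n)) → (∀ t → g (suc t) ≈ 0#) → sum g ≈ g zero
  sum-head g tail≈0 = trans (+-congˡ (sum-zero (tail g) tail≈0)) (+-identityʳ _)

  sum-neg : ∀ {n} (g : V n) → sum (λ t → - g t) ≈ - sum g
  sum-neg g = begin
    sum (λ t → - g t)      ≈⟨ sum-cong (λ t → sym (-1*x≈-x (g t))) ⟩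
    sum (λ t → - 1# * g t) ≈⟨ sym (*-distribˡ-sum (- 1#) g) ⟩
    - 1# * sum g           ≈⟨ -1*x≈-x (sum g) ⟩
    - sum g                ∎

  sum-linear : ∀ {n} a (g h k : V n) → (∀ t → g t ≈ a * h t + k t) → sum g ≈ a * sum h + sum k
  sum-linear a g h k g≈ah+k = begin
    sum g                          ≈⟨ sum-cong g≈ah+k ⟩
    sum (λ t → a * h t + k t)      ≈⟨ ∑-distrib-+ (λ t → a * h t) k ⟩
    sum (λ t → a * h t) + sum k    ≈⟨ +-congʳ (sym (*-distribˡ-sum a h)) ⟩
    a * sum h + sum k              ∎

  sum-δ : ∀ {n} (x : V n) t → sum (λ i → x i * δ i t) ≈ x t
  sum-δ x zero = trans (+-cong (*-identityʳ _) (sum-zero _ (λ i → zeroʳ (x (suc i))))) (+-identityʳ _)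
  sum-δ x (suc t) = trans (+-cong (zeroʳ _) (sum-δ (tail x) t)) (+-identityˡ _)

  altSum : ∀ {n} → V n → Carrier
  altSum g = sum (λ t → sgn t * g t)

  altSum-suc : ∀ {n} (g : V (suc n)) → altSum g ≈ g zero - altSum (tail g)
  altSum-suc g = begin
    1# * g zero + sum (λ t → - sgn t * g (suc t))          ≈⟨ +-cong (*-identityˡ (g zero)) (sum-cong λ t → sym (-‿distribˡ-* (sgn t) (g (suc t)))) ⟩
    g zero + sum (λ t → - (sgn t * g (suc t)))            ≈⟨ +-congˡ (sum-neg (λ t → sgn t * g (suc t))) ⟩
    g zero - altSum (tail g)                              ∎

  altSum-cong : ∀ {n} {g h : V n} → (∀ t → g t ≈ h t) → altSum g ≈ altSum h
  altSum-cong g≈h = sum-cong (λ t → *-congˡ (g≈h t))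

  altSum-linear : ∀ {n} a (g h k : V n) → (∀ t → g t ≈ a * h t + k t) → altSum g ≈ a * altSum h + altSum k
  altSum-linear a g h k g≈ah+k = sum-linear a _ _ _ λ t → begin
    sgn t * g t                       ≈⟨ *-congˡ (g≈ah+k t) ⟩
    sgn t * (a * h t + k t)           ≈⟨ distribˡ _ _ _ ⟩
    sgn t * (a * h t) + sgn t * k t   ≈⟨ +-congʳ (*-Props.x∙yz≈y∙xz _ _ _) ⟩
    a * (sgn t * h t) + sgn t * k t   ∎

  altSum-head : ∀ {n} (g : V (suc n)) → (∀ t → g (suc t) ≈ 0#) → altSum g ≈ g zero
  altSum-head g tail≈0 =
    trans (sum-head (λ t → sgn t * g t) (λ t → trans (*-congˡ (tail≈0 t)) (zeroʳ _))) (*-identityˡ (g zero))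

  altSum-neighbours : ∀ {n} (g : V (suc n)) (p : Fin n) →
    (∀ t → t ≢ inject₁ p → t ≢ suc p → g t ≈ 0#) → g (inject₁ p) ≈ g (suc p) → altSum g ≈ 0#
  altSum-neighbours {suc n} g zero others≈0 g₀≈g₁ = begin
    altSum g                                   ≈⟨ altSum-suc g ⟩
    g zero - altSum (tail g)                   ≈⟨ +-congˡ (-‿cong (altSum-suc (tail g))) ⟩
    g zero - (g (suc zero) - altSum rest)      ≈⟨ +-congˡ (-‿cong (+-congˡ (-‿cong rest≈0))) ⟩
    g zero - (g (suc zero) - 0#)               ≈⟨ +-congˡ (-‿cong (+-congˡ -0#≈0#)) ⟩
    g zero - (g (suc zero) + 0#)               ≈⟨ +-congˡ (-‿cong (+-identityʳ _)) ⟩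
    g zero - g (suc zero)                      ≈⟨ +-congˡ (-‿cong (sym g₀≈g₁)) ⟩
    g zero - g zero                            ≈⟨ -‿inverseʳ _ ⟩
    0#                                         ∎
    where
      rest = λ t → g (suc (suc t))
      rest≈0 : altSum rest ≈ 0#
      rest≈0 = sum-zero _ (λ t → trans (*-congˡ (others≈0 (suc (suc t)) (λ ()) (λ ()))) (zeroʳ _))
  altSum-neighbours {suc n} g (suc p) others≈0 gₚ≈gₚ₊₁ = begin
    altSum g                   ≈⟨ altSum-suc g ⟩
    g zero - altSum (tail g)   ≈⟨ +-cong (others≈0 zero (λ ()) (λ ())) (-‿cong tail≈0) ⟩
    0# - 0#                    ≈⟨ -‿inverseʳ 0# ⟩
    0#                         ∎
    where
      tail≈0 : altSum (tail g) ≈ 0#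
      tail≈0 = altSum-neighbours (tail g) p
        (λ t t≢p t≢p+1 → others≈0 (suc t) (t≢p ∘ suc-injective) (t≢p+1 ∘ suc-injective)) gₚ≈gₚ₊₁

  []≔-cong : ∀ {m n} (A : Vector (V n) m) p {x y : V n} → x ≋ y → A [ p ]≔ x ≋ₘ A [ p ]≔ y
  []≔-cong A zero x≋y zero = x≋y
  []≔-cong A zero x≋y (suc j) = λ i → refl
  []≔-cong A (suc p) x≋y zero = λ i → refl
  []≔-cong A (suc p) x≋y (suc j) = []≔-cong (tail A) p x≋y j

  []≔-self : ∀ {m n} (A : Vector (V n) m) p {x : V n} → x ≋ A p → A [ p ]≔ x ≋ₘ A
  []≔-self A zero x≋Ap zero = x≋Ap
  []≔-self A zero x≋Ap (suc j) = λ i → refl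
  []≔-self A (suc p) x≋Ap zero = λ i → refl
  []≔-self A (suc p) x≋Ap (suc j) = []≔-self (tail A) p x≋Ap j

  ≡⇒≋ : ∀ {n} {x y : V n} → x ≡ y → x ≋ y
  ≡⇒≋ x≡y i = ≡⇒≈ (≡.cong (λ v → v i) x≡y)

  ∷-[]≔ : ∀ {m n} (x : V n) (T : Vector (V n) m) p v → (x ∷ T [ p ]≔ v) ≋ₘ (x ∷ T) [ suc p ]≔ v
  ∷-[]≔ x T p v zero i = refl
  ∷-[]≔ x T p v (suc j) i = refl

  ∷-η : ∀ {m n} (A : Vector (V n) (suc m)) → (A zero ∷ tail A) ≋ₘ A
  ∷-η A zero i = refl
  ∷-η A (suc j) i = refl

  HasEqualNeighbours : ∀ {m n} → Vector (V n) m → Set ℓ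
  HasEqualNeighbours {zero} A = Lift ℓ ⊥
  HasEqualNeighbours {suc m} A = ∃ λ (p : Fin m) → A (inject₁ p) ≋ A (suc p)

  record IsAlternatingMultilinear {m n} (f : Vector (V n) m → Carrier) : Set (c ⊔ ℓ) where
    field
      cong : ∀ {A B} → A ≋ₘ B → f A ≈ f B
      linear : ∀ A p a x y → f (A [ p ]≔ (a • x +ᵥ y)) ≈ a * f (A [ p ]≔ x) + f (A [ p ]≔ y)
      alternating : ∀ A → HasEqualNeighbours A → f A ≈ 0#

    vanishes-at-0ᵥ : ∀ A p → f (A [ p ]≔ 0ᵥ) ≈ 0#
    vanishes-at-0ᵥ A p = x+x≈x⇒x≈0 _ (sym (begin
      f (A [ p ]≔ 0ᵥ)                         ≈⟨ cong ([]≔-cong A p λ i → sym 1·0+0≈0) ⟩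
      f (A [ p ]≔ (1# • 0ᵥ +ᵥ 0ᵥ))            ≈⟨ linear A p 1# 0ᵥ 0ᵥ ⟩
      1# * f (A [ p ]≔ 0ᵥ) + f (A [ p ]≔ 0ᵥ)  ≈⟨ +-congʳ (*-identityˡ _) ⟩
      f (A [ p ]≔ 0ᵥ) + f (A [ p ]≔ 0ᵥ)       ∎))
      where
        1·0+0≈0 : 1# * 0# + 0# ≈ 0#
        1·0+0≈0 = trans (+-identityʳ _) (zeroʳ 1#)

    additive : ∀ A p x y → f (A [ p ]≔ (x +ᵥ y)) ≈ f (A [ p ]≔ x) + f (A [ p ]≔ y)
    additive A p x y = begin
      f (A [ p ]≔ (x +ᵥ y))                 ≈⟨ cong ([]≔-cong A p λ i → +-congʳ (sym (*-identityˡ (x i)))) ⟩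
      f (A [ p ]≔ (1# • x +ᵥ y))            ≈⟨ linear A p 1# x y ⟩
      1# * f (A [ p ]≔ x) + f (A [ p ]≔ y)  ≈⟨ +-congʳ (*-identityˡ _) ⟩
      f (A [ p ]≔ x) + f (A [ p ]≔ y)       ∎

    homogeneous : ∀ A p a x → f (A [ p ]≔ (a • x)) ≈ a * f (A [ p ]≔ x)
    homogeneous A p a x = begin
      f (A [ p ]≔ (a • x))                    ≈⟨ cong ([]≔-cong A p λ i → sym (+-identityʳ _)) ⟩
      f (A [ p ]≔ (a • x +ᵥ 0ᵥ))              ≈⟨ linear A p a x 0ᵥ ⟩
      a * f (A [ p ]≔ x) + f (A [ p ]≔ 0ᵥ)    ≈⟨ +-congˡ (vanishes-at-0ᵥ A p) ⟩
      a * f (A [ p ]≔ x) + 0#                 ≈⟨ +-identityʳ _ ⟩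
      a * f (A [ p ]≔ x)                      ∎

    linear-sum : ∀ {k} A p (a : Fin k → Carrier) (vs : Fin k → V n) →
      f (A [ p ]≔ (λ t → sum (λ i → a i * vs i t))) ≈ sum (λ i → a i * f (A [ p ]≔ vs i))
    linear-sum {zero} A p a vs = vanishes-at-0ᵥ A p
    linear-sum {suc k} A p a vs = begin
      f (A [ p ]≔ (a zero • vs zero +ᵥ rest))                  ≈⟨ linear A p (a zero) (vs zero) rest ⟩
      a zero * f (A [ p ]≔ vs zero) + f (A [ p ]≔ rest)        ≈⟨ +-congˡ (linear-sum A p (tail a) (tail vs)) ⟩
      sum (λ i → a i * f (A [ p ]≔ vs i))                      ∎
      where rest = λ t → sum (λ i → a (suc i) * vs (suc i) t)

    -- Exchanging two arguments flips the sign, provided f vanishes whenever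
    -- those two arguments agree: with x, y the two arguments,
    -- 0 = f(…x+y…x+y…) = f(…x…y…) + f(…y…x…).
    antisymmetric : ∀ A {p q} → p ≢ q → (∀ B → B p ≋ B q → f B ≈ 0#) →
      f A ≈ - f ((A [ p ]≔ A q) [ q ]≔ A p)
    antisymmetric A {p} {q} p≢q vanish = inverseˡ-unique (f A) (f (U y x)) (begin
      f A + f (U y x)                                   ≈⟨ +-congʳ (cong (λ j → ≋-sym (U-restores-A j))) ⟩
      f (U x y) + f (U y x)                             ≈⟨ +-cong (sym (+-identityˡ _)) (sym (+-identityʳ _)) ⟩
      (0# + f (U x y)) + (f (U y x) + 0#)               ≈⟨ +-cong (+-congʳ (sym (diagonal x))) (+-congˡ (sym (diagonal y))) ⟩
      (f (U x x) + f (U x y)) + (f (U y x) + f (U y y)) ≈⟨ sym (+-cong (additive _ q x y) (additive _ q x y)) ⟩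
      f (U x (x +ᵥ y)) + f (U y (x +ᵥ y))               ≈⟨ sym (additive-at-p x y (x +ᵥ y)) ⟩
      f (U (x +ᵥ y) (x +ᵥ y))                           ≈⟨ diagonal (x +ᵥ y) ⟩
      0#                                                ∎)
      where
        x = A p
        y = A q
        U : V n → V n → Vector (V n) m
        U u w = (A [ p ]≔ u) [ q ]≔ w
        U-restores-A : U x y ≋ₘ A
        U-restores-A j i = trans ([]≔-self (A [ p ]≔ x) q (≡⇒≋ (≡.sym (updateAt-minimal q p A (p≢q ∘ ≡.sym)))) j i)
                          ([]≔-self A p (λ _ → refl) j i)
        diagonal : ∀ u → f (U u u) ≈ 0#
        diagonal u = vanish (U u u) (≡⇒≋ (≡.trans (updateAt-minimal p q (A [ p ]≔ u) p≢q)
                                          (≡.trans (updateAt-updates p A) (≡.sym (updateAt-updates q (A [ p ]≔ u))))))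
        commute : ∀ u w → U u w ≋ₘ (A [ q ]≔ w) [ p ]≔ u
        commute u w j = ≡⇒≋ (updateAt-commutes q p (p≢q ∘ ≡.sym) A j)
        additive-at-p : ∀ u u′ w → f (U (u +ᵥ u′) w) ≈ f (U u w) + f (U u′ w)
        additive-at-p u u′ w = begin
          f (U (u +ᵥ u′) w)                                             ≈⟨ cong (commute (u +ᵥ u′) w) ⟩
          f ((A [ q ]≔ w) [ p ]≔ (u +ᵥ u′))                             ≈⟨ additive _ p u u′ ⟩
          f ((A [ q ]≔ w) [ p ]≔ u) + f ((A [ q ]≔ w) [ p ]≔ u′)        ≈⟨ sym (+-cong (cong (commute u w)) (cong (commute u′ w))) ⟩
          f (U u w) + f (U u′ w)                                        ∎

  open IsAlternatingMultilinear

  fix-first : ∀ {m n} {f : Vector (V n) (suc m) → Carrier} → IsAlternatingMultilinear f →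
    (x : V n) → IsAlternatingMultilinear (λ T → f (x ∷ T))
  fix-first {m} {n} {f} isAM x = record
    { cong = λ T≋T′ → cong isAM λ { zero i → refl ; (suc j) → T≋T′ j }
    ; linear = λ T p a v w → begin
        f (x ∷ T [ p ]≔ (a • v +ᵥ w))                             ≈⟨ cong isAM (∷-[]≔ x T p _) ⟩
        f ((x ∷ T) [ suc p ]≔ (a • v +ᵥ w))                       ≈⟨ linear isAM (x ∷ T) (suc p) a v w ⟩
        a * f ((x ∷ T) [ suc p ]≔ v) + f ((x ∷ T) [ suc p ]≔ w)   ≈⟨ sym (+-cong (*-congˡ (cong isAM (∷-[]≔ x T p v)))
                                                                                  (cong isAM (∷-[]≔ x T p w))) ⟩
        a * f (x ∷ T [ p ]≔ v) + f (x ∷ T [ p ]≔ w)               ∎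
    ; alternating = λ T neighbours → alternating isAM (x ∷ T) (shift T neighbours)
    }
    where
      shift : ∀ {m} (T : Vector (V n) m) → HasEqualNeighbours T → HasEqualNeighbours (x ∷ T)
      shift {zero} T (lift ())
      shift {suc m} T (p , Tₚ≋Tₚ₊₁) = suc p , Tₚ≋Tₚ₊₁

  IsLinear : ∀ {n n′} → (V n → V n′) → Set (c ⊔ ℓ)
  IsLinear h = (∀ {x y} → x ≋ y → h x ≋ h y) × (∀ a x y → h (a • x +ᵥ y) ≋ a • h x +ᵥ h y)

  precompose : ∀ {m n n′} {f : Vector (V n′) m → Carrier} → IsAlternatingMultilinear f →
    (h : V n → V n′) → IsLinear h → IsAlternatingMultilinear (λ W → f (map h W))
  precompose {m} {n} {n′} {f} isAM h (h-cong , h-linear) = record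
    { cong = λ W≋W′ → cong isAM (λ j → h-cong (W≋W′ j))
    ; linear = λ W p a x y → begin
        f (map h (W [ p ]≔ (a • x +ᵥ y)))                             ≈⟨ cong isAM (map-[]≔ W p _) ⟩
        f (map h W [ p ]≔ h (a • x +ᵥ y))                             ≈⟨ cong isAM ([]≔-cong (map h W) p (h-linear a x y)) ⟩
        f (map h W [ p ]≔ (a • h x +ᵥ h y))                           ≈⟨ linear isAM (map h W) p a (h x) (h y) ⟩
        a * f (map h W [ p ]≔ h x) + f (map h W [ p ]≔ h y)           ≈⟨ sym (+-cong (*-congˡ (cong isAM (map-[]≔ W p x)))
                                                                                      (cong isAM (map-[]≔ W p y))) ⟩
        a * f (map h (W [ p ]≔ x)) + f (map h (W [ p ]≔ y))           ∎
    ; alternating = λ W neighbours → alternating isAM (map h W) (map-neighbours W neighbours)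
    }
    where
      map-[]≔ : ∀ W p v → map h (W [ p ]≔ v) ≋ₘ map h W [ p ]≔ h v
      map-[]≔ W p v j = ≡⇒≋ (map-updateAt {f = h} (λ _ → ≡.refl) W p j)
      map-neighbours : ∀ {m} (W : Vector (V n) m) → HasEqualNeighbours W → HasEqualNeighbours (map h W)
      map-neighbours {zero} W (lift ())
      map-neighbours {suc m} W (p , Wₚ≋Wₚ₊₁) = p , h-cong Wₚ≋Wₚ₊₁

  -- An alternating multilinear function vanishes when its first argument
  -- equals any other one, the (j+1)-th say: exchanging the first two
  -- arguments and then fixing the first one reduces j+1 to j.
  vanishes-first : ∀ {m n} {f : Vector (V n) (suc m) → Carrier} → IsAlternatingMultilinear f →
    ∀ A (j : Fin m) → A zero ≋ A (suc j) → f A ≈ 0#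
  vanishes-first isAM A zero A₀≋A₁ = alternating isAM A (zero , A₀≋A₁)
  vanishes-first {suc m} {f = f} isAM A (suc j) A₀≋Aⱼ = begin
    f A                    ≈⟨ antisymmetric isAM A (λ ()) (λ B B₀≋B₁ → alternating isAM B (zero , B₀≋B₁)) ⟩
    - f S                  ≈⟨ -‿cong (cong isAM (≋-symₘ (∷-η S))) ⟩
    - f (S zero ∷ tail S)  ≈⟨ -‿cong (vanishes-first (fix-first isAM (S zero)) (tail S) j A₀≋Aⱼ) ⟩
    - 0#                   ≈⟨ -0#≈0# ⟩
    0#                     ∎
    where
      S = (A [ zero ]≔ A (suc zero)) [ suc zero ]≔ A zero

  swap-first : ∀ {m n} {f : Vector (V n) (suc m) → Carrier} → IsAlternatingMultilinear f →
    ∀ A (j : Fin m) → f A ≈ - f ((A [ zero ]≔ A (suc j)) [ suc j ]≔ A zero)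
  swap-first isAM A j = antisymmetric isAM A (λ ()) (λ B B₀≋Bⱼ → vanishes-first isAM B j B₀≋Bⱼ)

  -- Square matrices, stored as the family of their columns: A j i is the
  -- entry in row i and column j.
  Matrix : ℕ → Set c
  Matrix n = Vector (V n) n

  transpose : ∀ {n} → Matrix n → Matrix n
  transpose A j i = A i j

  minor : ∀ {n} → Fin (suc n) → Matrix (suc n) → Matrix n
  minor t A j = tail (A (punchIn t j))

  det : ∀ {n} → Matrix n → Carrier
  det {zero} A = 1#
  det {suc n} A = altSum (λ t → A t zero * det (minor t A))

  det-cong : ∀ {n} {A B : Matrix n} → A ≋ₘ B → det A ≈ det B
  det-cong {zero} _ = refl
  det-cong {suc n} A≋B = altSum-cong (λ t → *-cong (A≋B t zero) (det-cong (λ j i → A≋B (punchIn t j) (suc i))))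

  -- Two equal neighbouring columns p, p+1: their expansion terms cancel, and
  -- every other minor again has two equal neighbouring columns.
  det-neighbours : ∀ {n} (A : Matrix (suc n)) (p : Fin n) → A (inject₁ p) ≋ A (suc p) → det A ≈ 0#
  det-neighbours {suc n} A p Aₚ≋Aₚ₊₁ = altSum-neighbours _ p other-terms≈0 (*-cong (Aₚ≋Aₚ₊₁ zero) (det-cong minors-agree))
    where
      column : ∀ {s s′} → s ≡ s′ → A s ≋ A s′
      column = ≡⇒≋ ∘ ≡.cong A
      other-terms≈0 : ∀ t → t ≢ inject₁ p → t ≢ suc p → A t zero * det (minor t A) ≈ 0#
      other-terms≈0 t t≢p t≢p+1 with punchIn-neighbours t p t≢p t≢p+1
      ... | p′ , left , right = trans (*-congˡ (det-neighbours (minor t A) p′ minor-neighbours)) (zeroʳ _)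
        where
          minor-neighbours : minor t A (inject₁ p′) ≋ minor t A (suc p′)
          minor-neighbours i = trans (column left (suc i)) (trans (Aₚ≋Aₚ₊₁ (suc i)) (column (≡.sym right) (suc i)))
      minors-agree : minor (inject₁ p) A ≋ₘ minor (suc p) A
      minors-agree j i with j ≟ p
      ... | yes ≡.refl = trans (column (punchIn-inject₁-self j) (suc i))
                               (trans (sym (Aₚ≋Aₚ₊₁ (suc i))) (column (≡.sym (punchIn-suc-self j)) (suc i)))
      ... | no j≢p = column (≡.sym (punchIn-suc≡punchIn-inject₁ p j j≢p)) (suc i)

  minor-[]≔-self : ∀ {n} (A : Matrix (suc n)) t v → minor t (A [ t ]≔ v) ≋ₘ minor t A
  minor-[]≔-self A t v j = ≡⇒≋ (≡.cong tail (updateAt-minimal (punchIn t j) t A (punchInᵢ≢i t j)))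

  minor-[]≔ : ∀ {n} (A : Matrix (suc n)) {t p} (t≢p : t ≢ p) v →
    minor t (A [ p ]≔ v) ≋ₘ minor t A [ punchOut t≢p ]≔ tail v
  minor-[]≔ A {t} {p} t≢p v j with j ≟ punchOut t≢p
  ... | yes ≡.refl = ≡⇒≋ (≡.trans (≡.cong (tail ∘ (A [ p ]≔ v)) (punchIn-punchOut t≢p))
                        (≡.trans (≡.cong tail (updateAt-updates p A)) (≡.sym (updateAt-updates j (minor t A)))))
  ... | no j≢p′ = ≡⇒≋ (≡.trans (≡.cong tail (updateAt-minimal (punchIn t j) p A punchIn≢p))
                        (≡.sym (updateAt-minimal j (punchOut t≢p) (minor t A) j≢p′)))
    where
      punchIn≢p : punchIn t j ≢ p
      punchIn≢p e = j≢p′ (punchIn-injective t j (punchOut t≢p) (≡.trans e (≡.sym (punchIn-punchOut t≢p))))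

  -- Linearity in column p: the expansion term of column p is linear in its
  -- entry, every other term is linear by induction through its minor.
  det-linear : ∀ {n} (A : Matrix n) p a x y →
    det (A [ p ]≔ (a • x +ᵥ y)) ≈ a * det (A [ p ]≔ x) + det (A [ p ]≔ y)
  det-linear {suc n} A p a x y = altSum-linear a _ _ _ term-linear
    where
      term : V (suc n) → Fin (suc n) → Carrier
      term v t = (A [ p ]≔ v) t zero * det (minor t (A [ p ]≔ v))
      term-linear : ∀ t → term (a • x +ᵥ y) t ≈ a * term x t + term y t
      term-linear t with t ≟ p
      ... | yes ≡.refl = begin
          term (a • x +ᵥ y) t             ≈⟨ term-at (a • x +ᵥ y) ⟩
          (a * x zero + y zero) * D       ≈⟨ distribʳ D (a * x zero) (y zero) ⟩
          a * x zero * D + y zero * D     ≈⟨ +-congʳ (*-assoc a (x zero) D) ⟩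
          a * (x zero * D) + y zero * D   ≈⟨ sym (+-cong (*-congˡ (term-at x)) (term-at y)) ⟩
          a * term x t + term y t         ∎
        where
          D = det (minor t A)
          term-at : ∀ v → term v t ≈ v zero * D
          term-at v = *-cong (≡⇒≈ (≡.cong (λ w → w zero) (updateAt-updates t A))) (det-cong (minor-[]≔-self A t v))
      ... | no t≢p = begin
          term (a • x +ᵥ y) t                                       ≈⟨ term-away (a • x +ᵥ y) ⟩
          A t zero * det (M [ q ]≔ (a • tail x +ᵥ tail y))          ≈⟨ *-congˡ (det-linear M q a (tail x) (tail y)) ⟩
          A t zero * (a * X + Y)                                    ≈⟨ distribˡ _ _ _ ⟩
          A t zero * (a * X) + A t zero * Y                         ≈⟨ +-congʳ (*-Props.x∙yz≈y∙xz _ _ _) ⟩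
          a * (A t zero * X) + A t zero * Y                         ≈⟨ sym (+-cong (*-congˡ (term-away x)) (term-away y)) ⟩
          a * term x t + term y t                                   ∎
        where
          M = minor t A
          q = punchOut t≢p
          X = det (M [ q ]≔ tail x)
          Y = det (M [ q ]≔ tail y)
          term-away : ∀ v → term v t ≈ A t zero * det (M [ q ]≔ tail v)
          term-away v = *-cong (≡⇒≈ (≡.cong (λ w → w zero) (updateAt-minimal t p A t≢p))) (det-cong (minor-[]≔ A t≢p v))

  det-isAlternatingMultilinear : ∀ {n} → IsAlternatingMultilinear (det {n})
  det-isAlternatingMultilinear = record { cong = det-cong ; linear = det-linear ; alternating = det-alternating }
    where
      det-alternating : ∀ {n} (A : Matrix n) → HasEqualNeighbours A → det A ≈ 0#
      det-alternating {zero} A (lift ())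
      det-alternating {suc n} A (p , Aₚ≋Aₚ₊₁) = det-neighbours A p Aₚ≋Aₚ₊₁

  insert0 : ∀ {n} → Fin (suc n) → V n → V (suc n)
  insert0 i x = insertAt x i 0#

  insert0-linear : ∀ {n} (i : Fin (suc n)) → IsLinear (insert0 i)
  insert0-linear i = insert0-cong i , insert0-combination i
    where
      insert0-cong : ∀ {n} (i : Fin (suc n)) {x y : V n} → x ≋ y → insert0 i x ≋ insert0 i y
      insert0-cong zero x≋y zero = refl
      insert0-cong zero x≋y (suc t) = x≋y t
      insert0-cong {suc n} (suc i) x≋y zero = x≋y zero
      insert0-cong {suc n} (suc i) x≋y (suc t) = insert0-cong i (λ t → x≋y (suc t)) t
      insert0-combination : ∀ {n} (i : Fin (suc n)) a x y → insert0 i (a • x +ᵥ y) ≋ a • insert0 i x +ᵥ insert0 i y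
      insert0-combination zero a x y zero = sym (trans (+-identityʳ _) (zeroʳ a))
      insert0-combination zero a x y (suc t) = refl
      insert0-combination {suc n} (suc i) a x y zero = refl
      insert0-combination {suc n} (suc i) a x y (suc t) = insert0-combination i a (tail x) (tail y) t

  split-coordinate : ∀ {n} (i : Fin (suc n)) (x : V (suc n)) → x ≋ x i • δ i +ᵥ insert0 i (x ∘ punchIn i)
  split-coordinate i x t = trans (≡⇒≈ (≡.sym (insertAt-removeAt x i t))) (split i (x i) (x ∘ punchIn i) t)
    where
      split : ∀ {n} (i : Fin (suc n)) a (y : V n) → insertAt y i a ≋ a • δ i +ᵥ insert0 i y
      split zero a y zero = sym (trans (+-identityʳ _) (*-identityʳ a))
      split zero a y (suc t) = sym (trans (+-congʳ (zeroʳ a)) (+-identityˡ _))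
      split {suc n} (suc i) a y zero = sym (trans (+-congʳ (zeroʳ a)) (+-identityˡ _))
      split {suc n} (suc i) a y (suc t) = split i a (tail y) t

  insert0-δ : ∀ {n} (i : Fin (suc n)) (k : Fin n) → insert0 i (δ k) ≋ δ (punchIn i k)
  insert0-δ zero k zero = refl
  insert0-δ zero k (suc t) = refl
  insert0-δ {suc n} (suc i) zero zero = refl
  insert0-δ {suc n} (suc i) zero (suc t) = insert0-0ᵥ i t
    where
      insert0-0ᵥ : ∀ {n} (i : Fin (suc n)) → insert0 i 0ᵥ ≋ 0ᵥ
      insert0-0ᵥ zero zero = refl
      insert0-0ᵥ zero (suc t) = refl
      insert0-0ᵥ {suc n} (suc i) zero = refl
      insert0-0ᵥ {suc n} (suc i) (suc t) = insert0-0ᵥ i t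
  insert0-δ {suc n} (suc i) (suc k) zero = refl
  insert0-δ {suc n} (suc i) (suc k) (suc t) = insert0-δ i k t

  replace-each : ∀ {m n} (g : Vector (V n) m → Carrier) → (∀ {A B} → A ≋ₘ B → g A ≈ g B) →
    (W W′ : Vector (V n) m) → (∀ B l → g (B [ l ]≔ W l) ≈ g (B [ l ]≔ W′ l)) → g W ≈ g W′
  replace-each {zero} g g-cong W W′ exchange = g-cong (λ ())
  replace-each {suc m} g g-cong W W′ exchange = begin
    g W                      ≈⟨ g-cong (≋-symₘ ([]≔-self W zero (λ _ → refl))) ⟩
    g (W [ zero ]≔ W zero)   ≈⟨ exchange W zero ⟩
    g (W [ zero ]≔ W′ zero)  ≈⟨ g-cong (λ { zero i → refl ; (suc j) i → refl }) ⟩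
    g (W′ zero ∷ tail W)     ≈⟨ replace-each (λ T → g (W′ zero ∷ T)) g-cong-tail (tail W) (tail W′) exchange′ ⟩
    g (W′ zero ∷ tail W′)    ≈⟨ g-cong (∷-η W′) ⟩
    g W′                     ∎
    where
      g-cong-tail : ∀ {T T′} → T ≋ₘ T′ → g (W′ zero ∷ T) ≈ g (W′ zero ∷ T′)
      g-cong-tail T≋T′ = g-cong λ { zero i → refl ; (suc j) → T≋T′ j }
      exchange′ : ∀ B l → g (W′ zero ∷ B [ l ]≔ W (suc l)) ≈ g (W′ zero ∷ B [ l ]≔ W′ (suc l))
      exchange′ B l = trans (g-cong (∷-[]≔ (W′ zero) B l _))
                        (trans (exchange (W′ zero ∷ B) (suc l)) (g-cong (≋-symₘ (∷-[]≔ (W′ zero) B l _))))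

  ignores-coordinate : ∀ {m n} {h : Vector (V (suc n)) m → Carrier} → IsAlternatingMultilinear h →
    (i : Fin (suc n)) → (∀ B l → B l ≋ δ i → h B ≈ 0#) → ∀ T → h T ≈ h (λ k → insert0 i (T k ∘ punchIn i))
  ignores-coordinate {h = h} isAM i vanish T = replace-each h (cong isAM) T T′ exchange
    where
      T′ = λ k → insert0 i (T k ∘ punchIn i)
      exchange : ∀ B l → h (B [ l ]≔ T l) ≈ h (B [ l ]≔ T′ l)
      exchange B l = begin
        h (B [ l ]≔ T l)                                    ≈⟨ cong isAM ([]≔-cong B l (split-coordinate i (T l))) ⟩
        h (B [ l ]≔ (T l i • δ i +ᵥ T′ l))                  ≈⟨ linear isAM B l (T l i) (δ i) (T′ l) ⟩
        T l i * h (B [ l ]≔ δ i) + h (B [ l ]≔ T′ l)        ≈⟨ +-congʳ (*-congˡ (vanish _ l (≡⇒≋ (updateAt-updates l B)))) ⟩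
        T l i * 0# + h (B [ l ]≔ T′ l)                      ≈⟨ +-congʳ (zeroʳ _) ⟩
        0# + h (B [ l ]≔ T′ l)                              ≈⟨ +-identityˡ _ ⟩
        h (B [ l ]≔ T′ l)                                   ∎

  -- δᵢ followed by the remaining basis vectors in increasing order.  Moving
  -- δᵢ back to position i takes i exchanges, whence the sign (-1)ⁱ.
  basis-from : ∀ {n} → Fin (suc n) → Matrix (suc n)
  basis-from i = δ i ∷ (δ ∘ punchIn i)

  basis-from-sign : ∀ {n} {f : Matrix (suc n) → Carrier} → IsAlternatingMultilinear f →
    ∀ i → f (basis-from i) ≈ sgn i * f δ
  basis-from-sign {n} {f} isAM = <-weakInduction P at-zero step
    where
      P : Fin (suc n) → Set ℓ
      P i = f (basis-from i) ≈ sgn i * f δ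
      at-zero : P zero
      at-zero = trans (cong isAM (λ { zero t → refl ; (suc j) t → refl })) (sym (*-identityˡ _))
      step : ∀ i → P (inject₁ i) → P (suc i)
      step i P-inject₁ = begin
        f (basis-from (suc i))         ≈⟨ swap-first isAM (basis-from (suc i)) i ⟩
        - f S                          ≈⟨ -‿cong (cong isAM S≋basis-from) ⟩
        - f (basis-from (inject₁ i))   ≈⟨ -‿cong P-inject₁ ⟩
        - (sgn (inject₁ i) * f δ)      ≈⟨ -‿distribˡ-* _ _ ⟩
        - sgn (inject₁ i) * f δ        ≈⟨ *-congʳ (-‿cong (≡⇒≈ (sgn-inject₁ i))) ⟩
        sgn (suc i) * f δ              ∎
        where
          A = basis-from (suc i)
          S = (A [ zero ]≔ A (suc i)) [ suc i ]≔ A zero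
          S≋basis-from : S ≋ₘ basis-from (inject₁ i)
          S≋basis-from zero = ≡⇒≋ (≡.cong δ (punchIn-suc-self i))
          S≋basis-from (suc k) with k ≟ i
          ... | yes ≡.refl = ≡⇒≋ (≡.trans (updateAt-updates k _) (≡.cong δ (≡.sym (punchIn-inject₁-self k))))
          ... | no k≢i = ≡⇒≋ (≡.trans (updateAt-minimal k i _ k≢i) (≡.cong δ (punchIn-suc≡punchIn-inject₁ i k k≢i)))

  -- Expand the first argument C₀ = Σᵢ C₀ᵢ δᵢ; the term with
  -- δᵢ ignores the i-th coordinate of the other arguments, so it is an
  -- alternating multilinear function of a minor, handled by induction.
  det-unique : ∀ {n} (f : Matrix n → Carrier) → IsAlternatingMultilinear f → ∀ C → f C ≈ det (transpose C) * f δ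
  det-unique {zero} f isAM C = trans (cong isAM (λ ())) (sym (*-identityˡ _))
  det-unique {suc n} f isAM C = begin
    f C                                                                  ≈⟨ cong isAM (≋-symₘ ([]≔-self C zero (sum-δ (C zero)))) ⟩
    f (C [ zero ]≔ (λ t → sum (λ i → C zero i * δ i t)))                 ≈⟨ linear-sum isAM C zero (C zero) δ ⟩
    sum (λ i → C zero i * f (C [ zero ]≔ δ i))                           ≈⟨ sum-cong expansion-term ⟩
    sum (λ i → sgn i * (C zero i * det (minor i (transpose C))) * f δ)   ≈⟨ sym (*-distribʳ-sum (f δ) (λ i → sgn i * (C zero i * det (minor i (transpose C))))) ⟩
    det (transpose C) * f δ                                              ∎
    where
      expansion-term : ∀ i → C zero i * f (C [ zero ]≔ δ i) ≈ sgn i * (C zero i * det (minor i (transpose C))) * f δ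
      expansion-term i = begin
        C zero i * f (C [ zero ]≔ δ i)        ≈⟨ *-congˡ first-is-δᵢ ⟩
        C zero i * (det M * (sgn i * f δ))    ≈⟨ sym (*-assoc _ _ _) ⟩
        C zero i * det M * (sgn i * f δ)      ≈⟨ *-Props.x∙yz≈y∙xz _ _ _ ⟩
        sgn i * (C zero i * det M * f δ)      ≈⟨ sym (*-assoc _ _ _) ⟩
        sgn i * (C zero i * det M) * f δ      ∎
        where
          M = minor i (transpose C)
          g : Matrix n → Carrier
          g W = f (δ i ∷ map (insert0 i) W)
          first-is-δᵢ : f (C [ zero ]≔ δ i) ≈ det M * (sgn i * f δ)
          first-is-δᵢ = begin
            f (C [ zero ]≔ δ i)   ≈⟨ cong isAM (λ { zero t → refl ; (suc j) t → refl }) ⟩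
            f (δ i ∷ tail C)      ≈⟨ ignores-coordinate (fix-first isAM (δ i)) i
                                       (λ B l Bₗ≋δᵢ → vanishes-first isAM (δ i ∷ B) l (≋-sym Bₗ≋δᵢ)) (tail C) ⟩
            g (transpose M)       ≈⟨ det-unique g (precompose (fix-first isAM (δ i)) (insert0 i) (insert0-linear i)) (transpose M) ⟩
            det M * g δ           ≈⟨ *-congˡ (trans (cong isAM (λ { zero → ≋-refl ; (suc k) → insert0-δ i k }))
                                                    (basis-from-sign isAM i)) ⟩
            det M * (sgn i * f δ) ∎

  infixr 7 _·_
  _·_ : ∀ {n} → Matrix n → V n → V n
  (A · x) i = sum (λ l → A l i * x l)

  det-product : ∀ {n} (A W : Matrix n) → det (map (A ·_) W) ≈ det (transpose W) * det A
  det-product A W = trans (det-unique _ (precompose det-isAlternatingMultilinear (A ·_) (·-cong , ·-linear)) W)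
                          (*-congˡ (det-cong A·δ≋A))
    where
      ·-cong : ∀ {x y} → x ≋ y → A · x ≋ A · y
      ·-cong x≋y i = sum-cong (λ l → *-congˡ (x≋y l))
      ·-linear : ∀ a x y → A · (a • x +ᵥ y) ≋ a • (A · x) +ᵥ A · y
      ·-linear a x y i = sum-linear a _ (λ l → A l i * x l) (λ l → A l i * y l)
                           (λ l → trans (distribˡ _ _ _) (+-congʳ (*-Props.x∙yz≈y∙xz (A l i) a (x l))))
      A·δ≋A : map (A ·_) δ ≋ₘ A
      A·δ≋A j i = trans (sum-cong (λ l → *-congˡ (≡⇒≈ (δ-sym j l)))) (sum-δ (λ l → A l i) j)

  ∏ : ∀ {n} → V n → Carrier
  ∏ = foldr _*_ 1#

  det-diagonal : ∀ {n} (s : V n) → det (λ j → s j • δ j) ≈ ∏ s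
  det-diagonal {zero} s = refl
  det-diagonal {suc n} s = trans (altSum-head (λ t → s t * δ t zero * det (minor t (λ j → s j • δ j)))
                                              (λ t → trans (*-congʳ (zeroʳ _)) (zeroˡ _)))
                                 (*-cong (*-identityʳ _) (det-diagonal (tail s)))

  weight : ∀ {k} → Carrier → V (suc k)
  weight ξ = ξ ∷ const 1#

  sumF≡sum : ∀ {n} (g : V n) → sumF R g ≡ sum g
  sumF≡sum {zero} g = ≡.refl
  sumF≡sum {suc n} g = ≡.cong (g zero +_) (sumF≡sum (tail g))

  B-weighted : ∀ {k} ξ (x y : V (suc k)) → B R ξ x y ≈ sum (λ l → weight ξ l * (x l * y l))
  B-weighted ξ x y = +-congˡ (trans (≡⇒≈ (sumF≡sum (λ l → x (suc l) * y (suc l))))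
                                   (sum-cong (λ l → sym (*-identityˡ (x (suc l) * y (suc l))))))

  -- Gram determinant of pairwise orthogonal vectors v₀,…,vₖ: the Gram
  -- matrix (B(vᵢ,vⱼ)) = vᵀ·diag(ξ,1,…,1)·v is diag(Q(vⱼ)), so
  --   Q(v₀)⋯Q(vₖ) = ξ · det(v)².
  gram-determinant : ∀ {k} ξ (v : Matrix (suc k)) → (∀ a b → a ≢ b → B R ξ (v a) (v b) ≈ 0#) →
    ∏ (λ j → Q R ξ (v j)) ≈ ξ * (det (transpose v) * det (transpose v))
  gram-determinant ξ v orthogonal = begin
    ∏ (λ j → Q R ξ (v j))                ≈⟨ sym (det-diagonal (λ j → Q R ξ (v j))) ⟩
    det (λ j → Q R ξ (v j) • δ j)         ≈⟨ det-cong (≋-symₘ gram-diagonal) ⟩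
    det (map (X ·_) v)                    ≈⟨ det-product X v ⟩
    det vᵀ * det X                        ≈⟨ *-congˡ det-X ⟩
    det vᵀ * (ξ * det vᵀ)                 ≈⟨ *-Props.x∙yz≈y∙xz _ _ _ ⟩
    ξ * (det vᵀ * det vᵀ)                 ∎
    where
      vᵀ = transpose v
      -- vᵀ with its first row scaled by ξ, so that (X · vⱼ)ᵢ = B(vᵢ,vⱼ)
      X : Matrix _
      X l i = weight ξ l * v i l
      det-X : det X ≈ ξ * det vᵀ
      det-X = begin
        det X                             ≈⟨ det-cong {A = X} {B = vᵀ [ zero ]≔ (ξ • vᵀ zero)} (λ { zero i → refl ; (suc l) i → *-identityˡ _ }) ⟩
        det (vᵀ [ zero ]≔ (ξ • vᵀ zero))  ≈⟨ homogeneous det-isAlternatingMultilinear vᵀ zero ξ (vᵀ zero) ⟩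
        ξ * det (vᵀ [ zero ]≔ vᵀ zero)    ≈⟨ *-congˡ (det-cong ([]≔-self vᵀ zero ≋-refl)) ⟩
        ξ * det vᵀ                        ∎
      gram-entry : ∀ i j → (X · v j) i ≈ B R ξ (v i) (v j)
      gram-entry i j = trans (sum-cong (λ l → *-assoc (weight ξ l) (v i l) (v j l))) (sym (B-weighted ξ (v i) (v j)))
      gram-diagonal : map (X ·_) v ≋ₘ (λ j → Q R ξ (v j) • δ j)
      gram-diagonal j i with i ≟ j
      ... | yes ≡.refl = begin
        (X · v i) i       ≈⟨ gram-entry i i ⟩
        Q R ξ (v i)       ≈⟨ sym (*-identityʳ _) ⟩
        Q R ξ (v i) * 1#  ≈⟨ *-congˡ (≡⇒≈ (≡.sym (δ-diagonal i))) ⟩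
        Q R ξ (v i) * δ i i ∎
      ... | no i≢j = begin
        (X · v j) i       ≈⟨ gram-entry i j ⟩
        B R ξ (v i) (v j) ≈⟨ orthogonal i j i≢j ⟩
        0#                ≈⟨ sym (zeroʳ _) ⟩
        Q R ξ (v j) * 0#  ≈⟨ *-congˡ (≡⇒≈ (≡.sym (δ-off-diagonal j i (i≢j ∘ ≡.sym)))) ⟩
        Q R ξ (v j) * δ j i ∎

  ∏-squares : ∀ {n} (s y : V n) → (∀ j → y j * y j ≈ s j) → ∏ s ≈ ∏ y * ∏ y
  ∏-squares {zero} s y _ = sym (*-identityˡ 1#)
  ∏-squares {suc n} s y yy≈s =
    trans (*-cong (sym (yy≈s zero)) (∏-squares (tail s) (tail y) (yy≈s ∘ suc))) (*-Props.interchange _ _ _ _)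

  module _ (isField : IsField R) where

    *-nonzero : ∀ {a b} → ¬ a ≈ 0# → ¬ b ≈ 0# → ¬ a * b ≈ 0#
    *-nonzero {a} {b} a≉0 b≉0 ab≈0 with proj₂ isField a a≉0
    ... | a⁻¹ , aa⁻¹≈1 = b≉0 (begin
      b              ≈⟨ sym (*-identityˡ b) ⟩
      1# * b         ≈⟨ *-congʳ (sym aa⁻¹≈1) ⟩
      a * a⁻¹ * b    ≈⟨ *-Props.xy∙z≈y∙xz a a⁻¹ b ⟩
      a⁻¹ * (a * b)  ≈⟨ *-congˡ ab≈0 ⟩
      a⁻¹ * 0#       ≈⟨ zeroʳ a⁻¹ ⟩
      0#             ∎)

    ∏-nonzero : ∀ {n} (s : V n) → (∀ j → ¬ s j ≈ 0#) → ¬ ∏ s ≈ 0#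
    ∏-nonzero {zero} s _ = proj₁ isField
    ∏-nonzero {suc n} s s≉0 = *-nonzero (s≉0 zero) (∏-nonzero (tail s) (s≉0 ∘ suc))

    -- If k+1 pairwise orthogonal vectors of F^(k+1) all have nonzero square
    -- values under Q, then ξ is a square: by the Gram determinant,
    -- ξ = (∏ⱼ yⱼ / det v)² where Q(vⱼ) = yⱼ².
    orthogonal-squares⇒square : ∀ {k} ξ (v : Matrix (suc k)) →
      (∀ a → IsNonzeroSquare R (Q R ξ (v a))) → (∀ a b → a ≢ b → B R ξ (v a) (v b) ≈ 0#) → IsSquare R ξ
    orthogonal-squares⇒square ξ v squares orthogonal = ∏ y * d⁻¹ , (begin
      ∏ y * d⁻¹ * (∏ y * d⁻¹)        ≈⟨ *-Props.interchange _ _ _ _ ⟩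
      ∏ y * ∏ y * (d⁻¹ * d⁻¹)        ≈⟨ *-congʳ (sym (∏-squares s y (proj₂ ∘ proj₂ ∘ squares))) ⟩
      ∏ s * (d⁻¹ * d⁻¹)              ≈⟨ *-congʳ gram ⟩
      ξ * (d * d) * (d⁻¹ * d⁻¹)      ≈⟨ *-assoc _ _ _ ⟩
      ξ * (d * d * (d⁻¹ * d⁻¹))      ≈⟨ *-congˡ (*-Props.interchange _ _ _ _) ⟩
      ξ * (d * d⁻¹ * (d * d⁻¹))      ≈⟨ *-congˡ (*-cong dd⁻¹≈1 dd⁻¹≈1) ⟩
      ξ * (1# * 1#)                  ≈⟨ *-congˡ (*-identityˡ 1#) ⟩
      ξ * 1#                         ≈⟨ *-identityʳ ξ ⟩
      ξ                              ∎)
      where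
        s : V _
        s j = Q R ξ (v j)
        y : V _
        y j = proj₁ (proj₂ (squares j))
        d = det (transpose v)
        gram : ∏ s ≈ ξ * (d * d)
        gram = gram-determinant ξ v orthogonal
        d≉0 : ¬ d ≈ 0#
        d≉0 d≈0 = ∏-nonzero s (proj₁ ∘ squares) (trans gram (trans (*-congˡ (*-congʳ d≈0)) (trans (*-congˡ (zeroˡ d)) (zeroʳ ξ))))
        d⁻¹ = proj₁ (proj₂ isField d d≉0)
        dd⁻¹≈1 : d * d⁻¹ ≈ 1#
        dd⁻¹≈1 = proj₂ (proj₂ isField d d≉0)

mainTheorem1 : {c ℓ : Level} (q k : ℕ) → OddPrimePower q → 2 ≤ k →
    (F : CommutativeRing c ℓ) → IsFiniteFieldOfOrder F q →
    (ξ : CommutativeRing.Carrier F) → ¬ IsSquare F ξ →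
    ¬ (Σ (Fin k → (Fin k → CommutativeRing.Carrier F)) λ v → IsClique F ξ v)
mainTheorem1 q zero _ ()
mainTheorem1 q (suc k) _ _ F (isField , _) ξ ξ-nonsquare (v , vertices , edges) =
  ξ-nonsquare (LinearAlgebra.orthogonal-squares⇒square F isField ξ v
    (λ a → proj₂ (vertices a)) (λ a b a≢b → proj₂ (edges a b a≢b)))
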